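{- For all $n\in\mathbb{N}$, we have $b(n)\le b(n+1)$ and $s(n)\le s(n+1)$, where $b(m)$ is the minimum number such that every temporal bi-clique with $m$ vertices on each side admits a bi-spanner with at most $b(m)$ edges, and $s(m)$ is the minimum number such that every temporal clique with $m$ vertices admits a spanner with at most $s(m)$ edges.
   Context: A temporal graph is $(V,E,\lambda)$ with $\lambda\colon E\to\mathbb{N}$. A path $v_1\dots v_k$ is temporal if $\lambda(\{v_i,v_{i+1}\})\le\lambda(\{v_{i+1},v_{i+2}\})$ for all $i\in[k-2]$. A temporal clique has a complete underlying graph; a spanner is an edge set $S$ such that every vertex reaches every other vertex by a temporal path within $S$. A temporal bi-clique $(A,B,\lambda)$ has the complete bipartite graph with disjoint parts $A,B$ as underlying graph; a bi-spanner is an edge set $S$ such that every $a\in A$ reaches every $b\in B$ by a temporal path within $S$. -}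

module Defs where

open import Data.Nat using (ℕ; _≤_)
open import Data.Fin using (Fin)
open import Data.List using (List; []; _∷_; _++_; [_]; length)
open import Data.List.Membership.Propositional using (_∈_)
open import Data.List.Relation.Unary.All using (All)
open import Data.List.Relation.Unary.Unique.Propositional using (Unique)
open import Data.Product using (Σ; ∃; _×_; _,_; proj₁; proj₂)
open import Data.Sum using (_⊎_; inj₁; inj₂)
open import Data.Unit using (⊤)
open import Data.Empty using (⊥)
open import Relation.Binary.PropositionalEquality using (_≡_; _≢_)

module Temporal {V : Set} (InS : V → V → Set) (lab : V → V → ℕ) where

  Steps : List V → Set
  Steps []              = ⊤
  Steps (x ∷ [])        = ⊤
  Steps (x ∷ y ∷ r)     = InS x y × Steps (y ∷ r)

  Mono : List V → Set
  Mono (x ∷ y ∷ z ∷ r)  = lab x y ≤ lab y z × Mono (y ∷ z ∷ r)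
  Mono _                = ⊤

  TemporalPath : List V → Set
  TemporalPath p = Unique p × Steps p × Mono p

  Reaches : V → V → Set
  Reaches u v = Σ (List V) λ mid → TemporalPath (u ∷ mid ++ [ v ])

-- Temporal cliques on the vertex set Fin n.
-- A labelling λ : E → ℕ of the complete graph is a symmetric function
-- Fin n → Fin n → ℕ (diagonal values are irrelevant).

Labelling : ℕ → Set
Labelling n = Fin n → Fin n → ℕ

Symmetric : ∀ {n} → Labelling n → Set
Symmetric {n} λ′ = (i j : Fin n) → λ′ i j ≡ λ′ j i

-- an edge set is a list of vertex pairs, each pair denoting the edge {u,v}
CliqueEdgeIn : ∀ {n} → List (Fin n × Fin n) → Fin n → Fin n → Set
CliqueEdgeIn S u v = (u , v) ∈ S ⊎ (v , u) ∈ S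

IsSpanner : (n : ℕ) → Labelling n → List (Fin n × Fin n) → Set
IsSpanner n λ′ S =
  All (λ e → proj₁ e ≢ proj₂ e) S ×
  ((u v : Fin n) → u ≢ v → Temporal.Reaches (CliqueEdgeIn S) λ′ u v)

SpannerBound : ℕ → ℕ → Set
SpannerBound m k =
  (λ′ : Labelling m) → Symmetric λ′ →
  Σ (List (Fin m × Fin m)) λ S → IsSpanner m λ′ S × length S ≤ k

IsS : ℕ → ℕ → Set
IsS m k = SpannerBound m k × ((j : ℕ) → SpannerBound m j → k ≤ j)

-- Temporal bi-cliques with parts A = inj₁ (Fin n), B = inj₂ (Fin n).
-- A labelling assigns λ a b to the edge {a , b}.
-- An edge set is a list of pairs (a , b) ∈ A × B.

BiVertex : ℕ → Set
BiVertex n = Fin n ⊎ Fin n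

BiEdgeIn : ∀ {n} → List (Fin n × Fin n) → BiVertex n → BiVertex n → Set
BiEdgeIn S (inj₁ a) (inj₂ b) = (a , b) ∈ S
BiEdgeIn S (inj₂ b) (inj₁ a) = (a , b) ∈ S
BiEdgeIn S _        _        = ⊥

biLab : ∀ {n} → Labelling n → BiVertex n → BiVertex n → ℕ
biLab λ′ (inj₁ a) (inj₂ b) = λ′ a b
biLab λ′ (inj₂ b) (inj₁ a) = λ′ a b
biLab λ′ _        _        = 0

IsBiSpanner : (n : ℕ) → Labelling n → List (Fin n × Fin n) → Set
IsBiSpanner n λ′ S =
  (a b : Fin n) → Temporal.Reaches (BiEdgeIn S) (biLab λ′) (inj₁ a) (inj₂ b)

BiSpannerBound : ℕ → ℕ → Set
BiSpannerBound m k =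
  (λ′ : Labelling m) →
  Σ (List (Fin m × Fin m)) λ S → IsBiSpanner m λ′ S × length S ≤ k

IsB : ℕ → ℕ → Set
IsB m k = BiSpannerBound m k × ((j : ℕ) → BiSpannerBound m j → k ≤ j)

-- Any instance on n vertices (per side) embeds in one on n + 1 vertices by adding a twin of
-- vertex 0, i.e. by pulling its labelling back along the map identifying vertices 0 and 1.
-- Projecting a (bi-)spanner of the larger instance along that map gives a (bi-)spanner of the
-- smaller one with no more edges: a temporal path projects to a temporal walk (an edge between
-- the twins disappears, every other edge keeps its label), and erasing the loops of a temporal
-- walk leaves a temporal path. Hence every bound valid for n + 1 is valid for n, so the least
-- bounds b and s are monotone.
module Submission where

open import Defs
open import Data.Nat using (ℕ; zero; suc; _≤_; z≤n)
open import Data.Nat.Properties using (≤-trans; ≤-reflexive)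
open import Data.Product using (_×_; Σ; _,_; proj₁; proj₂)
open import Data.Sum using (inj₁; inj₂)
import Data.Sum as Sum
open import Data.Sum.Properties using (≡-dec)
open import Data.Fin using (Fin; zero; suc)
open import Data.Fin.Properties using (suc-injective; _≟_)
open import Data.List using (List; []; _∷_; _++_; [_]; length; map; filter)
open import Data.List.Properties using (length-map; length-filter)
open import Data.List.Membership.Propositional using (_∈_)
open import Data.List.Membership.Propositional.Properties using (∈-map⁺; ∈-filter⁺)
import Data.List.Membership.DecPropositional as DecMembership
open import Data.List.Relation.Unary.Any using (here; there)
open import Data.List.Relation.Unary.All using ([])
open import Data.List.Relation.Unary.All.Properties using (¬Any⇒All¬; all-filter)
open import Data.List.Relation.Unary.AllPairs using ([]; _∷_)
open import Data.List.Relation.Unary.Unique.Propositional using (Unique)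
open import Data.Unit using (tt)
open import Function using (_∘_)
open import Relation.Binary.Definitions using (DecidableEquality)
open import Relation.Nullary using (yes; no; ¬?)
open import Relation.Binary.PropositionalEquality using (_≡_; _≢_; refl; sym; cong; subst)

module TemporalWalk {V : Set} (InS : V → V → Set) (lab : V → V → ℕ) where
  open Temporal InS lab

  data Walk (lo : ℕ) : V → V → Set where
    stop : ∀ {v} → Walk lo v v
    step : ∀ {u x v} → InS u x → lo ≤ lab u x → Walk (lab u x) x v → Walk lo u v

  tail : ∀ {lo u v} → Walk lo u v → List V
  tail stop                 = []
  tail (step {x = x} _ _ w) = x ∷ tail w

  vertices : ∀ {lo u v} → Walk lo u v → List V
  vertices {u = u} w = u ∷ tail w

  interior : ∀ {lo u v} → Walk lo u v → List V
  interior stop                              = []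
  interior (step _ _ stop)                   = []
  interior (step {x = x} _ _ w@(step _ _ _)) = x ∷ interior w

  tail-step : ∀ {lo u x v} (e : InS u x) (le : lo ≤ lab u x) (w : Walk (lab u x) x v) →
              tail (step e le w) ≡ interior (step e le w) ++ [ v ]
  tail-step _ _ stop                  = refl
  tail-step {x = x} _ _ (step e le w) = cong (x ∷_) (tail-step e le w)

  steps-vertices : ∀ {lo u v} (w : Walk lo u v) → Steps (vertices w)
  steps-vertices stop                      = tt
  steps-vertices (step e _ stop)           = e , tt
  steps-vertices (step e _ w@(step _ _ _)) = e , steps-vertices w

  mono-vertices : ∀ {lo u v} (w : Walk lo u v) → Mono (vertices w)
  mono-vertices stop                       = tt
  mono-vertices (step _ _ stop)            = tt
  mono-vertices (step _ _ w@(step _ le _)) = le , mono-vertices w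

  weaken : ∀ {lo ℓ u v} → lo ≤ ℓ → Walk ℓ u v → Walk lo u v
  weaken _ stop          = stop
  weaken p (step e le w) = step e (≤-trans p le) w

  vertices-weaken : ∀ {lo ℓ u v} (p : lo ≤ ℓ) (w : Walk ℓ u v) → vertices (weaken p w) ≡ vertices w
  vertices-weaken _ stop         = refl
  vertices-weaken _ (step _ _ _) = refl

  reaches⇒walk : ∀ {u v} → Reaches u v → Walk 0 u v
  reaches⇒walk {u} {v} (mid , _ , st , mo) = go u mid st mo z≤n
    where
    firstOr : List V → V
    firstOr []      = v
    firstOr (y ∷ _) = y

    go : ∀ {lo} x mid → Steps (x ∷ mid ++ [ v ]) → Mono (x ∷ mid ++ [ v ]) →
         lo ≤ lab x (firstOr mid) → Walk lo x v
    go x []            (e , _)  _          le = step e le stop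
    go x (y ∷ [])      (e , st) (mo , _)   le = step e le (go y [] st tt mo)
    go x (y ∷ z ∷ mid) (e , st) (mo , mos) le = step e le (go y (z ∷ mid) st mos mo)

  walk⇒reaches : ∀ {lo u v} (w : Walk lo u v) → u ≢ v → Unique (vertices w) → Reaches u v
  walk⇒reaches stop u≢v _ with () ← u≢v refl
  walk⇒reaches {u = u} w@(step e le w′) _ U =
    interior w ,
    subst TemporalPath (cong (u ∷_) (tail-step e le w′)) (U , steps-vertices w , mono-vertices w)

  SimpleWalk : ℕ → V → V → Set
  SimpleWalk lo u v = Σ (Walk lo u v) (Unique ∘ vertices)

  weaken-simple : ∀ {lo ℓ u v} → lo ≤ ℓ → SimpleWalk ℓ u v → SimpleWalk lo u v
  weaken-simple p (w , U) = weaken p w , subst Unique (sym (vertices-weaken p w)) U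

  module _ (_≟V_ : DecidableEquality V) where
    open DecMembership _≟V_ using (_∈?_)

    suffix : ∀ {lo y u v} (w : Walk lo y v) → u ∈ vertices w → Unique (vertices w) →
             SimpleWalk lo u v
    suffix w             (here refl) U       = w , U
    suffix (step _ le w) (there u∈w) (_ ∷ U) = weaken-simple le (suffix w u∈w U)

    loop-erase : ∀ {lo u v} → Walk lo u v → SimpleWalk lo u v
    loop-erase stop = stop , [] ∷ []
    loop-erase {u = u} (step e le w) with loop-erase w
    ... | w′ , U with u ∈? vertices w′
    ...   | yes u∈w′ = weaken-simple le (suffix w′ u∈w′ U)
    ...   | no  u∉w′ = step e le w′ , ¬Any⇒All¬ (vertices w′) u∉w′ ∷ U

-- An edge whose endpoints are identified is dropped, so `edge-map` need only hold for the others.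
module ReachesMap {V V′ : Set} (InS : V → V → Set) (lab : V → V → ℕ)
                  (InS′ : V′ → V′ → Set) (lab′ : V′ → V′ → ℕ)
                  (f : V → V′) (_≟V′_ : DecidableEquality V′)
                  (edge-map : ∀ {u w} → InS u w → f u ≢ f w → InS′ (f u) (f w))
                  (lab-map : ∀ u w → lab u w ≡ lab′ (f u) (f w)) where
  open TemporalWalk InS lab using (Walk; stop; step; reaches⇒walk)
  open TemporalWalk InS′ lab′ using (walk⇒reaches; loop-erase)
    renaming (Walk to Walk′; stop to stop′; step to step′; weaken to weaken′)

  map-walk : ∀ {lo u v} → Walk lo u v → Walk′ lo (f u) (f v)
  map-walk stop = stop′
  map-walk {lo} {u} {v} (step {x = x} e le w) with f u ≟V′ f x
  ... | yes fu≡fx = subst (λ y → Walk′ lo y (f v)) (sym fu≡fx) (weaken′ le (map-walk w))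
  ... | no  fu≢fx = step′ (edge-map e fu≢fx) (subst (lo ≤_) (lab-map u x) le)
                          (subst (λ k → Walk′ k (f x) (f v)) (lab-map u x) (map-walk w))

  reaches-map : ∀ {u v} → Temporal.Reaches InS lab u v → f u ≢ f v →
                Temporal.Reaches InS′ lab′ (f u) (f v)
  reaches-map r fu≢fv with w , U ← loop-erase _≟V′_ (map-walk (reaches⇒walk r)) =
    walk⇒reaches w fu≢fv U

-- Identifies vertices 0 and 1; pulling a labelling back along it adds a twin of vertex 0.
collapse : ∀ {m} → Fin (suc (suc m)) → Fin (suc m)
collapse zero    = zero
collapse (suc i) = i

collapse-edge : ∀ {m} → Fin (suc (suc m)) × Fin (suc (suc m)) → Fin (suc m) × Fin (suc m)
collapse-edge (a , b) = collapse a , collapse b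

pullback : ∀ {m} → Labelling (suc m) → Labelling (suc (suc m))
pullback λ′ i j = λ′ (collapse i) (collapse j)

spannerBound-pred : ∀ n k → SpannerBound (suc n) k → SpannerBound n k
spannerBound-pred zero    k _     _  _   = [] , ([] , λ ()) , z≤n
spannerBound-pred (suc m) k bound λ′ sym-λ′
  with S , (_ , reaches) , |S|≤k ← bound (pullback λ′) (λ i j → sym-λ′ (collapse i) (collapse j)) =
  S′ , (all-filter loopless? (map collapse-edge S) , reaches′) , |S′|≤k
  where
  loopless? = λ (e : Fin (suc m) × Fin (suc m)) → ¬? (proj₁ e ≟ proj₂ e)
  S′ = filter loopless? (map collapse-edge S)

  |S′|≤k : length S′ ≤ k
  |S′|≤k = ≤-trans (length-filter loopless? (map collapse-edge S))
                   (≤-trans (≤-reflexive (length-map collapse-edge S)) |S|≤k)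

  edge-map : ∀ {u w} → CliqueEdgeIn S u w → collapse u ≢ collapse w →
             CliqueEdgeIn S′ (collapse u) (collapse w)
  edge-map (inj₁ uw∈S) ne = inj₁ (∈-filter⁺ loopless? (∈-map⁺ collapse-edge uw∈S) ne)
  edge-map (inj₂ wu∈S) ne = inj₂ (∈-filter⁺ loopless? (∈-map⁺ collapse-edge wu∈S) (ne ∘ sym))

  open ReachesMap (CliqueEdgeIn S) (pullback λ′) (CliqueEdgeIn S′) λ′ collapse _≟_ edge-map (λ _ _ → refl)

  reaches′ : (u v : Fin (suc m)) → u ≢ v → Temporal.Reaches (CliqueEdgeIn S′) λ′ u v
  reaches′ u v u≢v = reaches-map (reaches (suc u) (suc v) (u≢v ∘ suc-injective)) u≢v

biSpannerBound-pred : ∀ n k → BiSpannerBound (suc n) k → BiSpannerBound n k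
biSpannerBound-pred zero    k _     _  = [] , (λ ()) , z≤n
biSpannerBound-pred (suc m) k bound λ′ with S , reaches , |S|≤k ← bound (pullback λ′) =
  S′ , reaches′ , subst (_≤ k) (sym (length-map collapse-edge S)) |S|≤k
  where
  S′ = map collapse-edge S

  collapseᴮ : BiVertex (suc (suc m)) → BiVertex (suc m)
  collapseᴮ = Sum.map collapse collapse

  edge-map : ∀ {u w} → BiEdgeIn S u w → collapseᴮ u ≢ collapseᴮ w →
             BiEdgeIn S′ (collapseᴮ u) (collapseᴮ w)
  edge-map {inj₁ _} {inj₂ _} ab∈S _ = ∈-map⁺ collapse-edge ab∈S
  edge-map {inj₂ _} {inj₁ _} ab∈S _ = ∈-map⁺ collapse-edge ab∈S

  lab-map : ∀ u w → biLab (pullback λ′) u w ≡ biLab λ′ (collapseᴮ u) (collapseᴮ w)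
  lab-map (inj₁ _) (inj₁ _) = refl
  lab-map (inj₁ _) (inj₂ _) = refl
  lab-map (inj₂ _) (inj₁ _) = refl
  lab-map (inj₂ _) (inj₂ _) = refl

  open ReachesMap (BiEdgeIn S) (biLab (pullback λ′)) (BiEdgeIn S′) (biLab λ′)
    collapseᴮ (≡-dec _≟_ _≟_) edge-map lab-map

  reaches′ : (a b : Fin (suc m)) → Temporal.Reaches (BiEdgeIn S′) (biLab λ′) (inj₁ a) (inj₂ b)
  reaches′ a b = reaches-map (reaches (suc a) (suc b)) λ ()

lemma11 : (n : ℕ) →
    ((b₀ b₁ : ℕ) → IsB n b₀ → IsB (suc n) b₁ → b₀ ≤ b₁) ×
    ((s₀ s₁ : ℕ) → IsS n s₀ → IsS (suc n) s₁ → s₀ ≤ s₁)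
lemma11 n =
  (λ { _ b₁ (_ , least) (bound , _) → least b₁ (biSpannerBound-pred n b₁ bound) }) ,
  (λ { _ s₁ (_ , least) (bound , _) → least s₁ (spannerBound-pred n s₁ bound) })
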